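{- Let $G$ be a $k$-$\gamma_c$-critical graph having at least one cut vertex, let $\mathcal{C}$ be its set of cut vertices, let $D$ be a $\gamma_c$-set of $G$, let $B$ be a block of $G$, let $x,y\in V(B)$ with $xy\notin E(G)$, and let $D_{xy}$ be a $\gamma_c$-set of $G+xy$. Then $|(D_{xy}\cap V(B))\setminus\mathcal{C}| < |(D\cap V(B))\setminus\mathcal{C}|$.
   Context: A connected dominating set of $G$ is a set $D$ such that every vertex is in $D$ or adjacent to a vertex of $D$ and $G[D]$ is connected; $\gamma_c(G)$ is its minimum size, and a minimum one is a $\gamma_c$-set. $G$ is $k$-$\gamma_c$-critical if $\gamma_c(G)=k$ and $\gamma_c(G+uv)<k$ for all non-adjacent $u,v$. -}

module Defs where

open import Data.Nat using (ℕ; _≤_; _<_)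
open import Data.Bool using (Bool; true; false; _∨_; _∧_)
open import Data.Fin using (Fin; _≟_)
open import Data.Fin.Subset using (Subset; _∈_; _⊆_; ∣_∣; Nonempty; ⊤; _-_)
open import Data.Product using (Σ; ∃; ∃-syntax; _×_; _,_)
open import Data.Sum using (_⊎_)
open import Relation.Nullary using (¬_)
open import Relation.Nullary.Decidable using (⌊_⌋)
open import Relation.Binary.PropositionalEquality using (_≡_; _≢_)

record Graph (n : ℕ) : Set where
  field adj : Fin n → Fin n → Bool
open Graph public

Adj : ∀ {n} → Graph n → Fin n → Fin n → Set
Adj G u v = adj G u v ≡ true

Simple : ∀ {n} → Graph n → Set
Simple G = (∀ u v → adj G u v ≡ adj G v u) × (∀ u → adj G u u ≡ false)

addEdge : ∀ {n} → Graph n → Fin n → Fin n → Graph n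
adj (addEdge G x y) u v =
  adj G u v ∨ ((⌊ u ≟ x ⌋ ∧ ⌊ v ≟ y ⌋) ∨ (⌊ u ≟ y ⌋ ∧ ⌊ v ≟ x ⌋))

-- Walks inside the vertex set S (i.e. walks in the induced subgraph G[S]).
data Reach {n} (G : Graph n) (S : Subset n) : Fin n → Fin n → Set where
  here : ∀ {u} → u ∈ S → Reach G S u u
  step : ∀ {u w v} → u ∈ S → Adj G u w → Reach G S w v → Reach G S u v

Connected : ∀ {n} → Graph n → Subset n → Set
Connected G S = ∀ u v → u ∈ S → v ∈ S → Reach G S u v

-- v is a cut vertex of the induced subgraph G[S]: removing v increases
-- the number of components, i.e. disconnects two vertices that were connected.
CutVertexIn : ∀ {n} → Graph n → Subset n → Fin n → Set
CutVertexIn G S v =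
  v ∈ S × ∃[ u ] ∃[ w ] (u ∈ S × w ∈ S × u ≢ v × w ≢ v ×
    Reach G S u w × ¬ Reach G (S - v) u w)

CutVertex : ∀ {n} → Graph n → Fin n → Set
CutVertex G v = CutVertexIn G ⊤ v

-- A block: a maximal connected (induced) subgraph without a cut vertex,
-- identified with its vertex set.
IsBlock : ∀ {n} → Graph n → Subset n → Set
IsBlock G B =
  Nonempty B × Connected G B × (∀ v → ¬ CutVertexIn G B v) ×
  (∀ B' → B ⊆ B' → Nonempty B' → Connected G B' →
     (∀ v → ¬ CutVertexIn G B' v) → B' ⊆ B)

Dominating : ∀ {n} → Graph n → Subset n → Set
Dominating G D = ∀ v → v ∈ D ⊎ ∃[ u ] (u ∈ D × Adj G u v)

IsCDS : ∀ {n} → Graph n → Subset n → Set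
IsCDS G D = Dominating G D × Connected G D

IsγcSet : ∀ {n} → Graph n → Subset n → Set
IsγcSet G D = IsCDS G D × (∀ D' → IsCDS G D' → ∣ D ∣ ≤ ∣ D' ∣)

γc≡ : ∀ {n} → Graph n → ℕ → Set
γc≡ G k = ∃[ D ] (IsγcSet G D × ∣ D ∣ ≡ k)

Critical : ∀ {n} → Graph n → ℕ → Set
Critical G k = γc≡ G k ×
  (∀ u v → u ≢ v → ¬ Adj G u v → ∃[ j ] (j < k × γc≡ (addEdge G u v) j))

module Submission where

-- Suppose |(Dxy ∩ B) ∖ C| ≥ |(D ∩ B) ∖ C| and let D' agree with D on B ∖ C and
-- with Dxy elsewhere.  Then |D'| ≤ |Dxy| = γc(G + xy) < k, so it suffices to
-- show that D' is a connected dominating set of G.  This rests on: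
--   (1) the ear lemma: no path joining two distinct vertices of a block has
--       all its inner vertices outside the block, since the block together
--       with such a path would be a larger connected set without cut vertices;
--   (2) hence in a connected graph a vertex of a block with a neighbour outside
--       the block is a cut vertex, and walks between vertices of a block can be
--       projected into the block;
--   (3) cut vertices lie in every connected dominating set, both of G and of
--       G + xy, because removing a vertex never separates x from y.

open import Defs
open import Data.Nat using (ℕ; suc; _+_; _<_; _≤_)
open import Data.Nat.Properties
  using (+-suc; ≮⇒≥; +-cancelʳ-≤; +-monoʳ-≤; <-irrefl; _<?_; module ≤-Reasoning)
open import Data.Bool using (Bool; true; false; T; _∧_; _∨_; not; if_then_else_)
open import Data.Bool.Properties using (T-≡; T-∧; T-∨)
open import Data.Vec using () renaming ([] to []ᵥ; _∷_ to _∷ᵥ_; here to hereᵥ; there to thereᵥ)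
open import Data.Fin using (Fin; zero; _≟_)
open import Data.Fin.Properties using (all?; ¬∀⟶∃¬)
open import Data.Fin.Subset using (Subset; _∈_; _∉_; _∩_; _∪_; _─_; ∣_∣; _-_; ⊤; ⊥; _⊆_; ⁅_⁆; ⋃; Nonempty)
open import Data.Fin.Subset.Properties
  using (_∈?_; x∈p∩q⁺; x∈p∩q⁻; x∈p∪q⁺; x∈p∪q⁻; x∈p∧x≢y⇒x∈p-y; p─q⊆p; ∈⊤; x∈⁅x⁆; x∈⁅y⁆⇒x≡y; ∉⊥)
open import Data.List using (List; []; _∷_; _++_; [_]; map)
open import Data.List.Relation.Unary.Any using (here; there; any?)
open import Data.List.Membership.Propositional using () renaming (_∈_ to _∈ₗ_; _∉_ to _∉ₗ_)
open import Data.List.Membership.Propositional.Properties using (∈-++⁻; ∈-++⁺ʳ)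
open import Data.List.Relation.Binary.Subset.Propositional using () renaming (_⊆_ to _⊆ₗ_)
open import Data.List.Relation.Binary.Subset.Propositional.Properties using (∷⁺ʳ)
open import Data.Product using (∃-syntax; _×_; _,_; proj₁; proj₂)
open import Data.Sum using (_⊎_; inj₁; inj₂)
open import Data.Empty using (⊥-elim) renaming (⊥ to Empty)
open import Function using (_∘_)
open import Function.Bundles using (_⇔_; Equivalence)
open import Relation.Nullary using (¬_; Dec; yes; no)
open import Relation.Nullary.Decidable using (⌊_⌋; toWitness; fromWitness)
open import Relation.Binary.PropositionalEquality using (_≡_; _≢_; refl; sym; trans; cong)

private variable n : ℕ

_∈ₗ?_ : (p : Fin n) (qs : List (Fin n)) → Dec (p ∈ₗ qs)
p ∈ₗ? qs = any? (p ≟_) qs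

x∈p─q⇒x∉q : (p q : Subset n) {x : Fin n} → x ∈ p ─ q → x ∉ q
x∈p─q⇒x∉q (_ ∷ᵥ p) (false ∷ᵥ q) hereᵥ ()
x∈p─q⇒x∉q (_ ∷ᵥ p) (true ∷ᵥ q) {zero} () _
x∈p─q⇒x∉q (_ ∷ᵥ p) (_ ∷ᵥ q) (thereᵥ x∈p─q) (thereᵥ x∈q) = x∈p─q⇒x∉q p q x∈p─q x∈q

x∈p-y⇒x≢y : (p : Subset n) {x y : Fin n} → x ∈ p - y → x ≢ y
x∈p-y⇒x≢y p {y = y} x∈p-y refl = x∈p─q⇒x∉q p ⁅ y ⁆ x∈p-y (x∈⁅x⁆ y)

-‿mono : {S T : Subset n} {v : Fin n} → S ⊆ T → S - v ⊆ T - v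
-‿mono {S = S} S⊆T z∈S-v = x∈p∧x≢y⇒x∈p-y (S⊆T (p─q⊆p S _ z∈S-v)) (x∈p-y⇒x≢y S z∈S-v)

vertexSet : List (Fin n) → Subset n
vertexSet ps = ⋃ (map ⁅_⁆ ps)

∈-vertexSet⁺ : ∀ {z : Fin n} ps → z ∈ₗ ps → z ∈ vertexSet ps
∈-vertexSet⁺ (p ∷ ps) (here refl) = x∈p∪q⁺ (inj₁ (x∈⁅x⁆ p))
∈-vertexSet⁺ (p ∷ ps) (there z∈ps) = x∈p∪q⁺ (inj₂ (∈-vertexSet⁺ ps z∈ps))

∈-vertexSet⁻ : ∀ {z : Fin n} ps → z ∈ vertexSet ps → z ∈ₗ ps
∈-vertexSet⁻ [] z∈ = ⊥-elim (∉⊥ z∈)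
∈-vertexSet⁻ (p ∷ ps) z∈ with x∈p∪q⁻ ⁅ p ⁆ (vertexSet ps) z∈
... | inj₁ z∈⁅p⁆ = here (x∈⁅y⁆⇒x≡y p z∈⁅p⁆)
... | inj₂ z∈ps = there (∈-vertexSet⁻ ps z∈ps)

-- Adjacency is symmetric; this is all of simplicity that the argument uses.
Symmetric : Graph n → Set
Symmetric H = ∀ {u v} → Adj H u v → Adj H v u

simple⇒symmetric : (G : Graph n) → Simple G → Symmetric G
simple⇒symmetric G (adj-sym , _) {u} {v} u~v = trans (sym (adj-sym u v)) u~v

module _ {G : Graph n} where
  reach-start : ∀ {S u v} → Reach G S u v → u ∈ S
  reach-start (here u∈S) = u∈S
  reach-start (step u∈S _ _) = u∈S

  reach-mono : ∀ {S T u v} → S ⊆ T → Reach G S u v → Reach G T u v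
  reach-mono S⊆T (here u∈S) = here (S⊆T u∈S)
  reach-mono S⊆T (step u∈S u~w r) = step (S⊆T u∈S) u~w (reach-mono S⊆T r)

  reach-trans : ∀ {S u v w} → Reach G S u v → Reach G S v w → Reach G S u w
  reach-trans (here _) r = r
  reach-trans (step u∈S u~w r) r' = step u∈S u~w (reach-trans r r')

  reach-sym : Symmetric G → ∀ {S u v} → Reach G S u v → Reach G S v u
  reach-sym symm (here u∈S) = here u∈S
  reach-sym symm (step u∈S u~w r) = reach-trans (reach-sym symm r) (step (reach-start r) (symm u~w) (here u∈S))

  reach-dominator : Symmetric G → ∀ {D S} → Dominating G D → D ⊆ S →
    ∀ {z} → z ∈ S → ∃[ d ] (d ∈ D × Reach G S z d)
  reach-dominator symm dom D⊆S {z} z∈S with dom z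
  ... | inj₁ z∈D = z , z∈D , here z∈S
  ... | inj₂ (d , d∈D , d~z) = d , d∈D , step z∈S (symm d~z) (here (D⊆S d∈D))

  cds-spans : Symmetric G → ∀ {D S} → IsCDS G D → D ⊆ S → ∀ {u w} → u ∈ S → w ∈ S → Reach G S u w
  cds-spans symm (dom , conn) D⊆S u∈S w∈S
    with reach-dominator symm dom D⊆S u∈S | reach-dominator symm dom D⊆S w∈S
  ... | d₁ , d₁∈D , r₁ | d₂ , d₂∈D , r₂ =
    reach-trans r₁ (reach-trans (reach-mono D⊆S (conn d₁ d₂ d₁∈D d₂∈D)) (reach-sym symm r₂))

  separator∈cds : Symmetric G → ∀ {E} → IsCDS G E → ∀ {c u w} → u ≢ c → w ≢ c →
    ¬ Reach G (⊤ - c) u w → c ∈ E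
  separator∈cds symm {E} cds {c} u≢c w≢c separated with c ∈? E
  ... | yes c∈E = c∈E
  ... | no c∉E = ⊥-elim (separated (cds-spans symm cds E⊆⊤-c (avoids u≢c) (avoids w≢c)))
    where
    avoids : ∀ {z} → z ≢ c → z ∈ ⊤ - c
    avoids = x∈p∧x≢y⇒x∈p-y ∈⊤
    E⊆⊤-c : E ⊆ ⊤ - c
    E⊆⊤-c z∈E = avoids λ { refl → c∉E z∈E }

  no-cut⇒reach : ∀ {S} → Connected G S → (∀ v → ¬ CutVertexIn G S v) →
    ∀ {v u w} → v ∈ S → u ∈ S → w ∈ S → u ≢ v → w ≢ v → ¬ ¬ Reach G (S - v) u w
  no-cut⇒reach conn no-cut {v} {u} {w} v∈S u∈S w∈S u≢v w≢v separated =
    no-cut v (v∈S , u , w , u∈S , w∈S , u≢v , w≢v , conn u w u∈S w∈S , separated)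

-- A walk u, p₁, …, pₘ, v in G, recorded by the list of its inner vertices.
Chain : Graph n → Fin n → List (Fin n) → Fin n → Set
Chain G u [] v = Adj G u v
Chain G u (p ∷ ps) v = Adj G u p × Chain G p ps v

data Distinct {n} : List (Fin n) → Set where
  [] : Distinct []
  _∷_ : ∀ {p ps} → p ∉ₗ ps → Distinct ps → Distinct (p ∷ ps)

module _ {G : Graph n} where
  prefix : ∀ {s v} qs {p} → p ∈ₗ qs → Chain G s qs v → ∃[ as ] (Chain G s as p × as ⊆ₗ qs)
  prefix (q ∷ qs) (here refl) (s~q , _) = [] , s~q , λ ()
  prefix (q ∷ qs) (there p∈qs) (s~q , rest) with prefix qs p∈qs rest
  ... | as , chain , as⊆qs = q ∷ as , (s~q , chain) , ∷⁺ʳ q as⊆qs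

  suffix : ∀ {s v} qs {p} → p ∈ₗ qs → Chain G s qs v → Distinct qs →
    ∃[ bs ] (Chain G p bs v × bs ⊆ₗ qs × p ∉ₗ bs × Distinct bs)
  suffix (q ∷ qs) (here refl) (_ , rest) (q∉qs ∷ distinct) = qs , rest , there , q∉qs , distinct
  suffix (q ∷ qs) (there p∈qs) (_ , rest) (_ ∷ distinct) with suffix qs p∈qs rest distinct
  ... | bs , chain , bs⊆qs , p∉bs , distinct' = bs , chain , there ∘ bs⊆qs , p∉bs , distinct'

  loop-erase : ∀ {u v} p ps → Chain G u (p ∷ ps) v →
    ∃[ qs ] (Chain G u (p ∷ qs) v × Distinct (p ∷ qs) × qs ⊆ₗ ps)
  loop-erase p [] chain = [] , chain , ((λ ()) ∷ []) , λ ()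
  loop-erase p (p' ∷ ps) (u~p , rest) with loop-erase p' ps rest
  ... | qs , path , distinct , qs⊆ps with p ∈ₗ? (p' ∷ qs)
  ... | no p∉ = p' ∷ qs , (u~p , path) , (p∉ ∷ distinct) , ∷⁺ʳ p' qs⊆ps
  ... | yes p∈ with suffix (p' ∷ qs) p∈ path distinct
  ... | bs , path' , bs⊆ , p∉bs , distinct' =
    bs , (u~p , path') , (p∉bs ∷ distinct') , ∷⁺ʳ p' qs⊆ps ∘ bs⊆

  avoid : ∀ {c c'} ps {z} v → Distinct ps → Chain G c ps c' → z ∈ₗ ps →
    (∃[ as ] (Chain G c as z × as ⊆ₗ ps × v ∉ₗ as)) ⊎
    (∃[ bs ] (Chain G z bs c' × bs ⊆ₗ ps × v ∉ₗ bs))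
  avoid (q ∷ qs) v _ (c~q , _) (here refl) = inj₁ ([] , c~q , (λ ()) , λ ())
  avoid (q ∷ qs) v (q∉qs ∷ distinct) (c~q , rest) (there z∈qs) with avoid qs v distinct rest z∈qs
  ... | inj₂ (bs , chain , bs⊆qs , v∉bs) = inj₂ (bs , chain , there ∘ bs⊆qs , v∉bs)
  ... | inj₁ (as , chain , as⊆qs , v∉as) with v ≟ q
  ... | no v≢q = inj₁ (q ∷ as , (c~q , chain) , ∷⁺ʳ q as⊆qs ,
                       λ { (here v≡q) → v≢q v≡q ; (there v∈as) → v∉as v∈as })
  ... | yes refl with suffix qs z∈qs rest distinct
  ... | bs , chain' , bs⊆qs , _ , _ = inj₂ (bs , chain' , there ∘ bs⊆qs , q∉qs ∘ bs⊆qs)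

  chain⇒reach : ∀ {S u v} ps → Chain G u ps v → u ∈ S → (∀ {z} → z ∈ₗ ps → z ∈ S) → v ∈ S → Reach G S u v
  chain⇒reach [] u~v u∈S _ v∈S = step u∈S u~v (here v∈S)
  chain⇒reach (p ∷ ps) (u~p , rest) u∈S ps⊆S v∈S =
    step u∈S u~p (chain⇒reach ps rest (ps⊆S (here refl)) (ps⊆S ∘ there) v∈S)

  chain-snoc : ∀ {u a b} ps → Chain G u ps a → Adj G a b → Chain G u (ps ++ [ a ]) b
  chain-snoc [] u~a a~b = u~a , a~b
  chain-snoc (p ∷ ps) (u~p , rest) a~b = u~p , chain-snoc ps rest a~b

AddedEdge : Graph n → Fin n → Fin n → Fin n → Fin n → Set
AddedEdge G x y u v = Adj G u v ⊎ (u ≡ x × v ≡ y) ⊎ (u ≡ y × v ≡ x)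

module _ (G : Graph n) (x y : Fin n) where
  is-xy is-yx : Fin n → Fin n → Bool
  is-xy u v = ⌊ u ≟ x ⌋ ∧ ⌊ v ≟ y ⌋
  is-yx u v = ⌊ u ≟ y ⌋ ∧ ⌊ v ≟ x ⌋

  addEdge-adj⁻ : ∀ {u v} → Adj (addEdge G x y) u v → AddedEdge G x y u v
  addEdge-adj⁻ {u} {v} u~v
    with Equivalence.to (T-∨ {adj G u v} {is-xy u v ∨ is-yx u v}) (Equivalence.from T-≡ u~v)
  ... | inj₁ old = inj₁ (Equivalence.to T-≡ old)
  ... | inj₂ new with Equivalence.to (T-∨ {is-xy u v} {is-yx u v}) new
  ... | inj₁ xy with Equivalence.to (T-∧ {⌊ u ≟ x ⌋} {⌊ v ≟ y ⌋}) xy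
  ...   | u≟x , v≟y = inj₂ (inj₁ (toWitness u≟x , toWitness v≟y))
  addEdge-adj⁻ {u} {v} u~v | inj₂ new | inj₂ yx with Equivalence.to (T-∧ {⌊ u ≟ y ⌋} {⌊ v ≟ x ⌋}) yx
  ...   | u≟y , v≟x = inj₂ (inj₂ (toWitness u≟y , toWitness v≟x))

  addEdge-adj⁺ : ∀ {u v} → AddedEdge G x y u v → Adj (addEdge G x y) u v
  addEdge-adj⁺ e = Equivalence.to T-≡ (Equivalence.from T-∨ (disjunct e))
    where
    disjunct : ∀ {u v} → AddedEdge G x y u v → T (adj G u v) ⊎ T (is-xy u v ∨ is-yx u v)
    disjunct (inj₁ old) = inj₁ (Equivalence.from T-≡ old)
    disjunct (inj₂ (inj₁ (refl , refl))) =
      inj₂ (Equivalence.from (T-∨ {is-xy x y}) (inj₁ (Equivalence.from (T-∧ {⌊ x ≟ x ⌋} {⌊ y ≟ y ⌋})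
             (fromWitness refl , fromWitness refl))))
    disjunct (inj₂ (inj₂ (refl , refl))) =
      inj₂ (Equivalence.from (T-∨ {is-xy y x}) (inj₂ (Equivalence.from (T-∧ {⌊ y ≟ y ⌋} {⌊ x ≟ x ⌋})
             (fromWitness refl , fromWitness refl))))

  addEdge-symmetric : Symmetric G → Symmetric (addEdge G x y)
  addEdge-symmetric symm u~v with addEdge-adj⁻ u~v
  ... | inj₁ old = addEdge-adj⁺ (inj₁ (symm old))
  ... | inj₂ (inj₁ (u≡x , v≡y)) = addEdge-adj⁺ (inj₂ (inj₂ (v≡y , u≡x)))
  ... | inj₂ (inj₂ (u≡y , v≡x)) = addEdge-adj⁺ (inj₂ (inj₁ (v≡x , u≡y)))

  reach-addEdge⁻ : Symmetric G → ∀ {S} → (x ∈ S → y ∈ S → ¬ ¬ Reach G S x y) →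
    ∀ {u w} → Reach (addEdge G x y) S u w → ¬ ¬ Reach G S u w
  reach-addEdge⁻ symm x~y (here u∈S) k = k (here u∈S)
  reach-addEdge⁻ symm x~y (step u∈S u~v r) k with addEdge-adj⁻ u~v
  ... | inj₁ old = reach-addEdge⁻ symm x~y r (k ∘ step u∈S old)
  ... | inj₂ (inj₁ (refl , refl)) =
    x~y u∈S (reach-start r) λ rxy → reach-addEdge⁻ symm x~y r (k ∘ reach-trans rxy)
  ... | inj₂ (inj₂ (refl , refl)) =
    x~y (reach-start r) u∈S λ rxy → reach-addEdge⁻ symm x~y r (k ∘ reach-trans (reach-sym symm rxy))

module Ear {n} (G : Graph n) (symm : Symmetric G) {B : Subset n}
  (connB : Connected G B) (no-cutB : ∀ v → ¬ CutVertexIn G B v)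
  {c c' : Fin n} (c∈B : c ∈ B) (c'∈B : c' ∈ B) (c≢c' : c ≢ c')
  (L : List (Fin n)) (path : Chain G c L c') (distinct : Distinct L)
  (outside : ∀ {z} → z ∈ₗ L → z ∉ B) where

  B' : Subset n
  B' = B ∪ vertexSet L

  B⊆B' : B ⊆ B'
  B⊆B' z∈B = x∈p∪q⁺ (inj₁ z∈B)

  L⊆B' : ∀ {z} → z ∈ₗ L → z ∈ B'
  L⊆B' z∈L = x∈p∪q⁺ (inj₂ (∈-vertexSet⁺ L z∈L))

  B'-cases : ∀ {z} → z ∈ B' → z ∈ B ⊎ z ∈ₗ L
  B'-cases z∈B' with x∈p∪q⁻ B (vertexSet L) z∈B'
  ... | inj₁ z∈B = inj₁ z∈B
  ... | inj₂ z∈L = inj₂ (∈-vertexSet⁻ L z∈L)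

  ear-connected : Connected G B'
  ear-connected u w u∈B' w∈B' = reach-trans (to-c u∈B') (reach-sym symm (to-c w∈B'))
    where
    to-c : ∀ {z} → z ∈ B' → Reach G B' z c
    to-c z∈B' with B'-cases z∈B'
    ... | inj₁ z∈B = reach-mono B⊆B' (connB _ c z∈B c∈B)
    ... | inj₂ z∈L with prefix L z∈L path
    ... | as , chain , as⊆L = reach-sym symm (chain⇒reach as chain (B⊆B' c∈B) (L⊆B' ∘ as⊆L) z∈B')

  module _ (v : Fin n) where
    along : ∀ {u w} as → Chain G u as w → as ⊆ₗ L → v ∉ₗ as → u ∈ B' - v → w ∈ B' - v → Reach G (B' - v) u w
    along as chain as⊆L v∉as u∈ w∈ =
      chain⇒reach as chain u∈ (λ z∈as → x∈p∧x≢y⇒x∈p-y (L⊆B' (as⊆L z∈as)) λ { refl → v∉as z∈as }) w∈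

    Hub : Fin n → Set
    Hub h = ∀ {z} → z ∈ B' → z ≢ v → ¬ ¬ Reach G (B' - v) z h

    hub⇒not-cut : ∀ {h} → Hub h → ¬ CutVertexIn G B' v
    hub⇒not-cut hub (_ , u , w , u∈B' , w∈B' , u≢v , w≢v , _ , separated) =
      hub u∈B' u≢v λ r₁ → hub w∈B' w≢v λ r₂ → separated (reach-trans r₁ (reach-sym symm r₂))

    -- For v ∈ B, the path avoids v, so an end of the path other than v is a hub.
    module _ (v∈B : v ∈ B) where
      v∉ : ∀ {as} → as ⊆ₗ L → v ∉ₗ as
      v∉ as⊆L v∈as = outside (as⊆L v∈as) v∈B

      via-block : ∀ {h z} → h ∈ B → h ≢ v → z ∈ B' → z ≢ v → (z ∈ₗ L → Reach G (B' - v) z h) →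
        ¬ ¬ Reach G (B' - v) z h
      via-block h∈B h≢v z∈B' z≢v from-L with B'-cases z∈B'
      ... | inj₁ z∈B = λ k → no-cut⇒reach connB no-cutB v∈B z∈B h∈B z≢v h≢v (k ∘ reach-mono (-‿mono B⊆B'))
      ... | inj₂ z∈L = λ k → k (from-L z∈L)

      backwards-to-c : c ≢ v → ∀ {z} → z ∈ₗ L → z ≢ v → Reach G (B' - v) z c
      backwards-to-c c≢v z∈L z≢v with prefix L z∈L path
      ... | as , chain , as⊆L = reach-sym symm (along as chain as⊆L (v∉ as⊆L)
                                  (x∈p∧x≢y⇒x∈p-y (B⊆B' c∈B) c≢v) (x∈p∧x≢y⇒x∈p-y (L⊆B' z∈L) z≢v))

      forwards-to-c' : c' ≢ v → ∀ {z} → z ∈ₗ L → z ≢ v → Reach G (B' - v) z c'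
      forwards-to-c' c'≢v z∈L z≢v with suffix L z∈L path distinct
      ... | bs , chain , bs⊆L , _ , _ = along bs chain bs⊆L (v∉ bs⊆L)
                                          (x∈p∧x≢y⇒x∈p-y (L⊆B' z∈L) z≢v) (x∈p∧x≢y⇒x∈p-y (B⊆B' c'∈B) c'≢v)

      hub-in-block : ∃[ h ] Hub h
      hub-in-block with c ≟ v
      ... | no c≢v = c , λ z∈B' z≢v → via-block c∈B c≢v z∈B' z≢v (λ z∈L → backwards-to-c c≢v z∈L z≢v)
      ... | yes refl = c' , λ z∈B' z≢v → via-block c'∈B c'≢c z∈B' z≢v (λ z∈L → forwards-to-c' c'≢c z∈L z≢v)
        where
        c'≢c : c' ≢ c
        c'≢c = c≢c' ∘ sym

    -- For v ∉ B, every vertex of B' reaches c avoiding v: along the path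
    -- backwards to c, or forwards to c' and then inside B.
    module _ (v∉B : v ∉ B) where
      B⊆B'-v : B ⊆ B' - v
      B⊆B'-v z∈B = x∈p∧x≢y⇒x∈p-y (B⊆B' z∈B) λ { refl → v∉B z∈B }

      hub-on-ear : Hub c
      hub-on-ear z∈B' z≢v k with B'-cases z∈B'
      ... | inj₁ z∈B = k (reach-mono B⊆B'-v (connB _ c z∈B c∈B))
      ... | inj₂ z∈L with avoid L v distinct path z∈L
      ... | inj₁ (as , chain , as⊆L , v∉as) =
        k (reach-sym symm (along as chain as⊆L v∉as (B⊆B'-v c∈B) (x∈p∧x≢y⇒x∈p-y z∈B' z≢v)))
      ... | inj₂ (bs , chain , bs⊆L , v∉bs) =
        k (reach-trans (along bs chain bs⊆L v∉bs (x∈p∧x≢y⇒x∈p-y z∈B' z≢v) (B⊆B'-v c'∈B))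
                       (reach-mono B⊆B'-v (connB c' c c'∈B c∈B)))

  ear-no-cut : ∀ v → ¬ CutVertexIn G B' v
  ear-no-cut v with v ∈? B
  ... | yes v∈B = hub⇒not-cut v (proj₂ (hub-in-block v v∈B))
  ... | no v∉B = hub⇒not-cut v (hub-on-ear v v∉B)

module Block {n} (G : Graph n) (symm : Symmetric G) {B : Subset n} (block : IsBlock G B) where
  private
    connB : Connected G B
    connB = proj₁ (proj₂ block)
    no-cutB : ∀ v → ¬ CutVertexIn G B v
    no-cutB = proj₁ (proj₂ (proj₂ block))
    maximal : ∀ B' → B ⊆ B' → Nonempty B' → Connected G B' → (∀ v → ¬ CutVertexIn G B' v) → B' ⊆ B
    maximal = proj₂ (proj₂ (proj₂ block))

  -- The ear lemma: no walk with at least one inner vertex joins two distinct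
  -- vertices of B while all its inner vertices lie outside B.  Otherwise loop
  -- erasure yields an ear, and B with the ear contradicts maximality.
  no-ear : ∀ {c c'} → c ∈ B → c' ∈ B → c ≢ c' → ∀ ps {p} → p ∈ₗ ps → Chain G c ps c' →
    (∀ {z} → z ∈ₗ ps → z ∉ B) → Empty
  no-ear c∈B c'∈B c≢c' (p ∷ ps) _ walk ps-outside with loop-erase p ps walk
  ... | qs , path , distinct , qs⊆ps =
    outside (here refl) (maximal B' B⊆B' (p , p∈B') ear-connected ear-no-cut p∈B')
    where
    outside : ∀ {z} → z ∈ₗ p ∷ qs → z ∉ B
    outside (here refl) = ps-outside (here refl)
    outside (there z∈qs) = ps-outside (there (qs⊆ps z∈qs))
    open Ear G symm connB no-cutB c∈B c'∈B c≢c' (p ∷ qs) path distinct outside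
    p∈B' : p ∈ B'
    p∈B' = L⊆B' (here refl)

  first-entry : ∀ {S a t} → Reach G S a t → a ∉ B → t ∈ B →
    ∃[ ps ] ∃[ e ] (Chain G a ps e × e ∈ B × e ∈ S × (∀ {z} → z ∈ₗ ps → z ∉ B))
  first-entry (here _) a∉B t∈B = ⊥-elim (a∉B t∈B)
  first-entry (step {w = w} _ a~w rest) a∉B t∈B with w ∈? B
  ... | yes w∈B = [] , w , a~w , w∈B , reach-start rest , λ ()
  ... | no w∉B with first-entry rest w∉B t∈B
  ... | ps , e , chain , e∈B , e∈S , ps-outside =
    w ∷ ps , e , (a~w , chain) , e∈B , e∈S , λ { (here refl) → w∉B ; (there z∈ps) → ps-outside z∈ps }

  first-exit : ∀ {S a t} → Reach G S a t → a ∈ B → t ∉ B → ∃[ b ] ∃[ w ] (b ∈ B × w ∉ B × Adj G b w)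
  first-exit (here _) a∈B t∉B = ⊥-elim (t∉B a∈B)
  first-exit {a = a} (step {w = w} _ a~w rest) a∈B t∉B with w ∈? B
  ... | yes w∈B = first-exit rest w∈B t∉B
  ... | no w∉B = a , w , a∈B , w∉B , a~w

  -- In a connected graph, a vertex b of B with a neighbour w outside B is a cut
  -- vertex (if B has another vertex b₂): any walk from w to b₂ avoiding b
  -- would enter B at a vertex e ≠ b, and b, w, …, e would be an ear.
  boundary-cut-vertex : (∀ u v → Reach G ⊤ u v) → ∀ {b b₂ w} → b ∈ B → b₂ ∈ B → b₂ ≢ b →
    w ∉ B → Adj G b w → CutVertex G b
  boundary-cut-vertex conn {b} {b₂} {w} b∈B b₂∈B b₂≢b w∉B b~w =
    ∈⊤ , w , b₂ , ∈⊤ , ∈⊤ , w≢b , b₂≢b , conn w b₂ , separated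
    where
    w≢b : w ≢ b
    w≢b refl = w∉B b∈B
    separated : ¬ Reach G (⊤ - b) w b₂
    separated r with first-entry r w∉B b₂∈B
    ... | ps , e , chain , e∈B , e∈⊤-b , ps-outside =
      no-ear b∈B e∈B (x∈p-y⇒x≢y ⊤ e∈⊤-b ∘ sym) (w ∷ ps) (here refl) (b~w , chain)
        λ { (here refl) → w∉B ; (there z∈ps) → ps-outside z∈ps }

  snoc-outside : ∀ ps {a} → (∀ {q} → q ∈ₗ ps → q ∉ B) → a ∉ B → ∀ {q} → q ∈ₗ ps ++ [ a ] → q ∉ B
  snoc-outside ps ps-outside a∉B q∈ with ∈-++⁻ ps q∈
  ... | inj₁ q∈ps = ps-outside q∈ps
  ... | inj₂ (here refl) = a∉B

  -- Walks between vertices of B can be projected into B: by the ear lemma an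
  -- excursion out of B returns to the vertex where it left B, so it can be cut out.
  project : ∀ {S z h} → Reach G S z h → z ∈ B → h ∈ B → Reach G (S ∩ B) z h
  -- The walk is on an excursion z, ps, a out of B; continue from a.
  excursion : ∀ {S z a h} ps → Chain G z ps a → a ∉ B → (∀ {q} → q ∈ₗ ps → q ∉ B) →
    z ∈ B → z ∈ S → Reach G S a h → h ∈ B → Reach G (S ∩ B) z h

  project (here z∈S) z∈B h∈B = here (x∈p∩q⁺ (z∈S , z∈B))
  project (step {w = w} z∈S z~w rest) z∈B h∈B with w ∈? B
  ... | yes w∈B = step (x∈p∩q⁺ (z∈S , z∈B)) z~w (project rest w∈B h∈B)
  ... | no w∉B = excursion [] z~w w∉B (λ ()) z∈B z∈S rest h∈B

  excursion ps chain a∉B ps-outside z∈B z∈S (here _) h∈B = ⊥-elim (a∉B h∈B)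
  excursion {z = z} {a = a} ps chain a∉B ps-outside z∈B z∈S (step {w = w} _ a~w rest) h∈B with w ∈? B
  ... | no w∉B = excursion (ps ++ [ a ]) (chain-snoc ps chain a~w) w∉B (snoc-outside ps ps-outside a∉B)
                   z∈B z∈S rest h∈B
  ... | yes w∈B with z ≟ w
  ... | yes refl = project rest z∈B h∈B
  ... | no z≢w = ⊥-elim (no-ear z∈B w∈B z≢w (ps ++ [ a ]) (∈-++⁺ʳ ps (here refl))
                           (chain-snoc ps chain a~w) (snoc-outside ps ps-outside a∉B))

  block-survives-deletion : ∀ {c u w} → u ∈ B → w ∈ B → u ≢ c → w ≢ c → ¬ ¬ Reach G (⊤ - c) u w
  block-survives-deletion {c} u∈B w∈B u≢c w≢c with c ∈? B
  ... | yes c∈B = λ k → no-cut⇒reach connB no-cutB c∈B u∈B w∈B u≢c w≢c (k ∘ reach-mono (-‿mono λ _ → ∈⊤))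
  ... | no c∉B = λ k → k (reach-mono (λ z∈B → x∈p∧x≢y⇒x∈p-y ∈⊤ λ { refl → c∉B z∈B }) (connB _ _ u∈B w∈B))

  separation-persists : ∀ {x y} → x ∈ B → y ∈ B → ∀ {c u w} →
    ¬ Reach G (⊤ - c) u w → ¬ Reach (addEdge G x y) (⊤ - c) u w
  separation-persists {x} {y} x∈B y∈B separated r = reach-addEdge⁻ G x y symm x~y r separated
    where
    x~y : x ∈ ⊤ - _ → y ∈ ⊤ - _ → ¬ ¬ Reach G (⊤ - _) x y
    x~y x∈ y∈ = block-survives-deletion x∈B y∈B (x∈p-y⇒x≢y ⊤ x∈) (x∈p-y⇒x≢y ⊤ y∈)

  cut-vertex⇒outside : ∀ {v} → CutVertex G v → ∃[ w ] w ∉ B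
  cut-vertex⇒outside {v} (_ , u , w , _ , _ , u≢v , w≢v , _ , separated) with all? (_∈? B)
  ... | no ¬all = ¬∀⟶∃¬ n (_∈ B) (_∈? B) ¬all
  ... | yes all = ⊥-elim (no-cutB v (all v , u , w , all u , all w , u≢v , w≢v , connB u w (all u) (all w) ,
                                      separated ∘ reach-mono (-‿mono λ _ → ∈⊤)))

splice : Subset n → Subset n → Subset n → Subset n → Subset n
splice []ᵥ []ᵥ []ᵥ []ᵥ = []ᵥ
splice (a ∷ᵥ as) (b ∷ᵥ bs) (c ∷ᵥ cs) (d ∷ᵥ ds) = (if b ∧ not c then d else a) ∷ᵥ splice as bs cs ds

module _ (s u : ℕ) {t w : ℕ} (balanced : s + t ≡ u + w) where
  gain-right : suc (s + t) ≡ u + suc w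
  gain-right = trans (cong suc balanced) (sym (+-suc u w))

  lose-right : s + suc t ≡ suc (u + w)
  lose-right = trans (+-suc s t) (cong suc balanced)

  swap-right : suc (s + suc t) ≡ suc (u + suc w)
  swap-right = cong suc (trans lose-right (sym (+-suc u w)))

splice-count : (A B C D : Subset n) → ∣ splice A B C D ∣ + ∣ (A ∩ B) ─ C ∣ ≡ ∣ A ∣ + ∣ (D ∩ B) ─ C ∣
splice-count []ᵥ []ᵥ []ᵥ []ᵥ = refl
splice-count (false ∷ᵥ as) (false ∷ᵥ bs) (false ∷ᵥ cs) (false ∷ᵥ ds) = splice-count as bs cs ds
splice-count (false ∷ᵥ as) (false ∷ᵥ bs) (false ∷ᵥ cs) (true ∷ᵥ ds) = splice-count as bs cs ds
splice-count (false ∷ᵥ as) (false ∷ᵥ bs) (true ∷ᵥ cs) (false ∷ᵥ ds) = splice-count as bs cs ds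
splice-count (false ∷ᵥ as) (false ∷ᵥ bs) (true ∷ᵥ cs) (true ∷ᵥ ds) = splice-count as bs cs ds
splice-count (false ∷ᵥ as) (true ∷ᵥ bs) (true ∷ᵥ cs) (false ∷ᵥ ds) = splice-count as bs cs ds
splice-count (false ∷ᵥ as) (true ∷ᵥ bs) (true ∷ᵥ cs) (true ∷ᵥ ds) = splice-count as bs cs ds
splice-count (true ∷ᵥ as) (false ∷ᵥ bs) (false ∷ᵥ cs) (false ∷ᵥ ds) = cong suc (splice-count as bs cs ds)
splice-count (true ∷ᵥ as) (false ∷ᵥ bs) (false ∷ᵥ cs) (true ∷ᵥ ds) = cong suc (splice-count as bs cs ds)
splice-count (true ∷ᵥ as) (false ∷ᵥ bs) (true ∷ᵥ cs) (false ∷ᵥ ds) = cong suc (splice-count as bs cs ds)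
splice-count (true ∷ᵥ as) (false ∷ᵥ bs) (true ∷ᵥ cs) (true ∷ᵥ ds) = cong suc (splice-count as bs cs ds)
splice-count (true ∷ᵥ as) (true ∷ᵥ bs) (true ∷ᵥ cs) (false ∷ᵥ ds) = cong suc (splice-count as bs cs ds)
splice-count (true ∷ᵥ as) (true ∷ᵥ bs) (true ∷ᵥ cs) (true ∷ᵥ ds) = cong suc (splice-count as bs cs ds)
splice-count (false ∷ᵥ as) (true ∷ᵥ bs) (false ∷ᵥ cs) (false ∷ᵥ ds) = splice-count as bs cs ds
splice-count (false ∷ᵥ as) (true ∷ᵥ bs) (false ∷ᵥ cs) (true ∷ᵥ ds) =
  gain-right (∣ splice as bs cs ds ∣) (∣ as ∣) (splice-count as bs cs ds)
splice-count (true ∷ᵥ as) (true ∷ᵥ bs) (false ∷ᵥ cs) (false ∷ᵥ ds) =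
  lose-right (∣ splice as bs cs ds ∣) (∣ as ∣) (splice-count as bs cs ds)
splice-count (true ∷ᵥ as) (true ∷ᵥ bs) (false ∷ᵥ cs) (true ∷ᵥ ds) =
  swap-right (∣ splice as bs cs ds ∣) (∣ as ∣) (splice-count as bs cs ds)

splice-size : (A B C D : Subset n) → ∣ (D ∩ B) ─ C ∣ ≤ ∣ (A ∩ B) ─ C ∣ → ∣ splice A B C D ∣ ≤ ∣ A ∣
splice-size A B C D fewer = +-cancelʳ-≤ (∣ (A ∩ B) ─ C ∣) (∣ splice A B C D ∣) (∣ A ∣) (begin
  ∣ splice A B C D ∣ + ∣ (A ∩ B) ─ C ∣  ≡⟨ splice-count A B C D ⟩
  ∣ A ∣ + ∣ (D ∩ B) ─ C ∣               ≤⟨ +-monoʳ-≤ (∣ A ∣) fewer ⟩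
  ∣ A ∣ + ∣ (A ∩ B) ─ C ∣               ∎)
  where open ≤-Reasoning

∈-splice⁺ʳ : (A B C D : Subset n) {i : Fin n} → i ∈ B → i ∉ C → i ∈ D → i ∈ splice A B C D
∈-splice⁺ʳ (_ ∷ᵥ as) (true ∷ᵥ bs) (false ∷ᵥ cs) (true ∷ᵥ ds) hereᵥ _ hereᵥ = hereᵥ
∈-splice⁺ʳ (_ ∷ᵥ as) (true ∷ᵥ bs) (true ∷ᵥ cs) (_ ∷ᵥ ds) hereᵥ i∉C _ = ⊥-elim (i∉C hereᵥ)
∈-splice⁺ʳ (_ ∷ᵥ as) (_ ∷ᵥ bs) (_ ∷ᵥ cs) (_ ∷ᵥ ds) (thereᵥ i∈B) i∉C (thereᵥ i∈D) =
  thereᵥ (∈-splice⁺ʳ as bs cs ds i∈B (i∉C ∘ thereᵥ) i∈D)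

∈-splice⁺ˡ : (A B C D : Subset n) {i : Fin n} → (i ∉ B ⊎ i ∈ C) → i ∈ A → i ∈ splice A B C D
∈-splice⁺ˡ (true ∷ᵥ as) (false ∷ᵥ bs) (_ ∷ᵥ cs) (_ ∷ᵥ ds) _ hereᵥ = hereᵥ
∈-splice⁺ˡ (true ∷ᵥ as) (true ∷ᵥ bs) (true ∷ᵥ cs) (_ ∷ᵥ ds) _ hereᵥ = hereᵥ
∈-splice⁺ˡ (true ∷ᵥ as) (true ∷ᵥ bs) (false ∷ᵥ cs) (_ ∷ᵥ ds) (inj₁ i∉B) hereᵥ = ⊥-elim (i∉B hereᵥ)
∈-splice⁺ˡ (true ∷ᵥ as) (true ∷ᵥ bs) (false ∷ᵥ cs) (_ ∷ᵥ ds) (inj₂ ()) hereᵥ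
∈-splice⁺ˡ (_ ∷ᵥ as) (_ ∷ᵥ bs) (_ ∷ᵥ cs) (_ ∷ᵥ ds) (inj₁ i∉B) (thereᵥ i∈A) =
  thereᵥ (∈-splice⁺ˡ as bs cs ds (inj₁ (i∉B ∘ thereᵥ)) i∈A)
∈-splice⁺ˡ (_ ∷ᵥ as) (_ ∷ᵥ bs) (_ ∷ᵥ cs) (_ ∷ᵥ ds) (inj₂ (thereᵥ i∈C)) (thereᵥ i∈A) =
  thereᵥ (∈-splice⁺ˡ as bs cs ds (inj₂ i∈C) i∈A)

∈-splice⁻ : (A B C D : Subset n) {i : Fin n} → i ∈ splice A B C D →
  (i ∈ B × i ∉ C × i ∈ D) ⊎ ((i ∉ B ⊎ i ∈ C) × i ∈ A)
∈-splice⁻ (_ ∷ᵥ as) (false ∷ᵥ bs) (_ ∷ᵥ cs) (_ ∷ᵥ ds) hereᵥ = inj₂ (inj₁ (λ ()) , hereᵥ)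
∈-splice⁻ (_ ∷ᵥ as) (true ∷ᵥ bs) (true ∷ᵥ cs) (_ ∷ᵥ ds) hereᵥ = inj₂ (inj₂ hereᵥ , hereᵥ)
∈-splice⁻ (_ ∷ᵥ as) (true ∷ᵥ bs) (false ∷ᵥ cs) (_ ∷ᵥ ds) hereᵥ = inj₁ (hereᵥ , (λ ()) , hereᵥ)
∈-splice⁻ (_ ∷ᵥ as) (_ ∷ᵥ bs) (_ ∷ᵥ cs) (_ ∷ᵥ ds) (thereᵥ i∈) with ∈-splice⁻ as bs cs ds i∈
... | inj₁ (i∈B , i∉C , i∈D) = inj₁ (thereᵥ i∈B , (λ { (thereᵥ i∈C) → i∉C i∈C }) , thereᵥ i∈D)
... | inj₂ (inj₁ i∉B , i∈A) = inj₂ (inj₁ (λ { (thereᵥ i∈B) → i∉B i∈B }) , thereᵥ i∈A)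
... | inj₂ (inj₂ i∈C , i∈A) = inj₂ (inj₂ (thereᵥ i∈C) , thereᵥ i∈A)

-- The spliced set D' (D on B ∖ C, Dxy elsewhere) is a connected dominating set
-- of G.
module Splice {n} (G : Graph n) (symm : Symmetric G)
  {C : Subset n} (C-cut : ∀ v → (v ∈ C) ⇔ CutVertex G v) {v₀ : Fin n} (cut₀ : CutVertex G v₀)
  {D : Subset n} (cdsD : IsCDS G D)
  {B : Subset n} (block : IsBlock G B) {x y : Fin n} (x∈B : x ∈ B) (y∈B : y ∈ B) (x≢y : x ≢ y)
  {Dxy : Subset n} (cdsDxy : IsCDS (addEdge G x y) Dxy) where

  open Block G symm block

  G⁺ : Graph n
  G⁺ = addEdge G x y

  D' : Subset n
  D' = splice Dxy B C D

  connected : ∀ u v → Reach G ⊤ u v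
  connected u v = cds-spans symm cdsD (λ _ → ∈⊤) ∈⊤ ∈⊤

  -- Cut vertices of G lie in D and, since x, y share a block, also in Dxy.
  C⊆D : ∀ {c} → c ∈ C → c ∈ D
  C⊆D {c} c∈C with Equivalence.to (C-cut c) c∈C
  ... | _ , _ , _ , _ , _ , u≢c , w≢c , _ , separated = separator∈cds symm cdsD u≢c w≢c separated

  C⊆Dxy : ∀ {c} → c ∈ C → c ∈ Dxy
  C⊆Dxy {c} c∈C with Equivalence.to (C-cut c) c∈C
  ... | _ , _ , _ , _ , _ , u≢c , w≢c , _ , separated =
    separator∈cds (addEdge-symmetric G x y symm) cdsDxy u≢c w≢c (separation-persists x∈B y∈B separated)

  boundary∈C : ∀ {b w} → b ∈ B → w ∉ B → Adj G b w → b ∈ C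
  boundary∈C {b} b∈B w∉B b~w = Equivalence.from (C-cut b) (cut (b ≟ x))
    where
    cut : Dec (b ≡ x) → CutVertex G b
    cut (yes refl) = boundary-cut-vertex connected b∈B y∈B (x≢y ∘ sym) w∉B b~w
    cut (no b≢x) = boundary-cut-vertex connected b∈B x∈B (b≢x ∘ sym) w∉B b~w

  -- B contains a cut vertex h: G is not a single block, so a walk from x
  -- leaves B, and it does so through a cut vertex.
  hub : ∃[ h ] (h ∈ B × h ∈ C)
  hub with cut-vertex⇒outside cut₀
  ... | w₀ , w₀∉B with first-exit (connected x w₀) x∈B w₀∉B
  ... | b , w , b∈B , w∉B , b~w = b , b∈B , boundary∈C b∈B w∉B b~w

  h : Fin n
  h = proj₁ hub

  h∈B : h ∈ B
  h∈B = proj₁ (proj₂ hub)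

  h∈C : h ∈ C
  h∈C = proj₂ (proj₂ hub)

  -- Vertices kept from Dxy: those outside B ∖ C.
  Kept : Fin n → Set
  Kept z = z ∉ B ⊎ z ∈ C

  kept⊆D' : ∀ {z} → Kept z → z ∈ Dxy → z ∈ D'
  kept⊆D' = ∈-splice⁺ˡ Dxy B C D

  C⊆D' : ∀ {c} → c ∈ C → c ∈ D'
  C⊆D' c∈C = kept⊆D' (inj₂ c∈C) (C⊆Dxy c∈C)

  D∩B⊆D' : ∀ {z} → z ∈ B → z ∈ D → z ∈ D'
  D∩B⊆D' {z} z∈B z∈D with z ∈? C
  ... | yes z∈C = C⊆D' z∈C
  ... | no z∉C = ∈-splice⁺ʳ Dxy B C D z∈B z∉C z∈D

  neighbour-kept : ∀ {z w} → z ∉ B → Adj G w z → Kept w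
  neighbour-kept {w = w} z∉B w~z with w ∈? B
  ... | no w∉B = inj₁ w∉B
  ... | yes w∈B = inj₂ (boundary∈C w∈B z∉B w~z)

  -- The new edge lies inside B, so edges of G + xy leaving a vertex outside B are edges of G.
  old-edge : ∀ {z w} → z ∉ B → Adj G⁺ z w ⊎ Adj G⁺ w z → Adj G z w
  old-edge z∉B (inj₁ z~w) with addEdge-adj⁻ G x y z~w
  ... | inj₁ old = old
  ... | inj₂ (inj₁ (refl , _)) = ⊥-elim (z∉B x∈B)
  ... | inj₂ (inj₂ (refl , _)) = ⊥-elim (z∉B y∈B)
  old-edge z∉B (inj₂ w~z) = old-edge z∉B (inj₁ (addEdge-symmetric G x y symm w~z))

  -- Vertices of D ∩ B reach h in G[D'], by projecting a D-walk into B.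
  D∩B-reaches-hub : ∀ {z} → z ∈ B → z ∈ D → Reach G D' z h
  D∩B-reaches-hub z∈B z∈D =
    reach-mono (λ z∈D∩B → let (z∈D , z∈B) = x∈p∩q⁻ D B z∈D∩B in D∩B⊆D' z∈B z∈D)
      (project (proj₂ cdsD _ h z∈D (C⊆D h∈C)) z∈B h∈B)

  -- Kept vertices joined to h by a Dxy-walk in G + xy reach h in G[D']: outside
  -- B the walk uses edges of G and kept vertices; it enters B at a cut vertex.
  kept-reaches-hub : ∀ {z} → Reach G⁺ Dxy z h → Kept z → Reach G D' z h
  outside-reaches-hub : ∀ {z} → Reach G⁺ Dxy z h → z ∉ B → Reach G D' z h

  kept-reaches-hub {z} r kept with z ∈? B | kept
  ... | no z∉B | _ = outside-reaches-hub r z∉B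
  ... | yes z∈B | inj₁ z∉B = ⊥-elim (z∉B z∈B)
  ... | yes z∈B | inj₂ z∈C = D∩B-reaches-hub z∈B (C⊆D z∈C)

  outside-reaches-hub (here _) z∉B = ⊥-elim (z∉B h∈B)
  outside-reaches-hub {z} (step {w = w} z∈Dxy z~w r) z∉B =
    step (kept⊆D' (inj₁ z∉B) z∈Dxy) z~w' (kept-reaches-hub r (neighbour-kept z∉B (symm z~w')))
    where
    z~w' : Adj G z w
    z~w' = old-edge z∉B (inj₁ z~w)

  reaches-hub : ∀ {z} → z ∈ D' → Reach G D' z h
  reaches-hub z∈D' with ∈-splice⁻ Dxy B C D z∈D'
  ... | inj₁ (z∈B , _ , z∈D) = D∩B-reaches-hub z∈B z∈D
  ... | inj₂ (kept , z∈Dxy) = kept-reaches-hub (proj₂ cdsDxy _ h z∈Dxy (C⊆Dxy h∈C)) kept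

  D'-connected : Connected G D'
  D'-connected u v u∈D' v∈D' = reach-trans (reaches-hub u∈D') (reach-sym symm (reaches-hub v∈D'))

  -- Inside B, D dominates and B ∖ C is kept from D (a D-neighbour outside B
  -- makes v a cut vertex); outside B, Dxy dominates through edges of G.
  D'-dominating : Dominating G D'
  D'-dominating v with v ∈? B
  D'-dominating v | yes v∈B with proj₁ cdsD v
  ... | inj₁ v∈D = inj₁ (D∩B⊆D' v∈B v∈D)
  ... | inj₂ (u , u∈D , u~v) with u ∈? B
  ... | yes u∈B = inj₂ (u , D∩B⊆D' u∈B u∈D , u~v)
  ... | no u∉B = inj₁ (C⊆D' (boundary∈C v∈B u∉B (symm u~v)))
  D'-dominating v | no v∉B with proj₁ cdsDxy v
  ... | inj₁ v∈Dxy = inj₁ (kept⊆D' (inj₁ v∉B) v∈Dxy)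
  ... | inj₂ (u , u∈Dxy , u~v) = inj₂ (u , kept⊆D' (neighbour-kept v∉B u~v') u∈Dxy , u~v')
    where
    u~v' : Adj G u v
    u~v' = symm (old-edge v∉B (inj₂ u~v))

  D'-cds : IsCDS G D'
  D'-cds = D'-dominating , D'-connected

corollary1 : ∀ {n} (G : Graph n) → Simple G → (k : ℕ) → Critical G k →
    ∃[ v ] CutVertex G v →
    (C : Subset n) → (∀ v → (v ∈ C) ⇔ CutVertex G v) →
    (D : Subset n) → IsγcSet G D →
    (B : Subset n) → IsBlock G B →
    (x y : Fin n) → x ∈ B → y ∈ B → x ≢ y → ¬ Adj G x y →
    (Dxy : Subset n) → IsγcSet (addEdge G x y) Dxy →
    ∣ (Dxy ∩ B) ─ C ∣ < ∣ (D ∩ B) ─ C ∣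
corollary1 G simple k ((D₀ , (_ , D₀-min) , ∣D₀∣≡k) , critical) (v₀ , cut₀) C C-cut D (cdsD , _)
           B block x y x∈B y∈B x≢y x≁y Dxy (cdsDxy , Dxy-min)
  with ∣ (Dxy ∩ B) ─ C ∣ <? ∣ (D ∩ B) ─ C ∣ | critical x y x≢y x≁y
... | yes fewer | _ = fewer
... | no not-fewer | j , j<k , E , ((cdsE , _) , ∣E∣≡j) = ⊥-elim (<-irrefl refl (begin-strict
  k                ≡⟨ sym ∣D₀∣≡k ⟩
  ∣ D₀ ∣           ≤⟨ D₀-min D' D'-cds ⟩
  ∣ D' ∣           ≤⟨ splice-size Dxy B C D (≮⇒≥ not-fewer) ⟩
  ∣ Dxy ∣          ≤⟨ Dxy-min E cdsE ⟩
  ∣ E ∣            ≡⟨ ∣E∣≡j ⟩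
  j                <⟨ j<k ⟩
  k                ∎))
  where
  open ≤-Reasoning
  open Splice G (simple⇒symmetric G simple) C-cut cut₀ cdsD block x∈B y∈B x≢y cdsDxy
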